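{- Fix $n,d$ and $J=\{j_1<\dots<j_\ell\}\subseteq\{1,\dots,n\}$. There exists a path $C\in\mathcal{P}(n,d)$ with $\operatorname{st}(C)=J$ if and only if $j_k\ge 2k$ for all $1\le k\le\ell$ and $\ell\le d\le n-\ell$. Moreover, in this case such a path is unique.
   Context: $\mathcal{P}(n,d)$ is the set of words of length $n$ in $\mathbf{e}$ and $\mathbf{n}$ with exactly $d$ letters $\mathbf{e}$. For such a word $C$, scan positions left to right and mark position $i$ with $C_i=\mathbf{e}$ if the number of $\mathbf{n}$'s at positions $<i$ equals the number of unmarked $\mathbf{e}$'s at positions $<i$; $\operatorname{st}(C)$ is the set of positions of unmarked $\mathbf{e}$'s. -}

module Defs where

open import Data.Nat using (ℕ; zero; suc; _+_; _*_; _<_; _≤_)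
open import Data.Nat.Properties using (_≟_)
open import Data.List using (List; []; _∷_; length; lookup)
open import Data.List.Relation.Unary.All using (All)
open import Data.List.Relation.Unary.Linked using (Linked)
open import Data.Fin using (Fin; toℕ)
open import Data.Vec using (Vec; []; _∷_)
open import Data.Product using (_×_)
open import Relation.Nullary using (yes; no)
open import Relation.Binary.PropositionalEquality using (_≡_)

data Letter : Set where
  e n : Letter

count-e : ∀ {m} → Vec Letter m → ℕ
count-e [] = 0
count-e (e ∷ w) = suc (count-e w)
count-e (n ∷ w) = count-e w

record Path (len d : ℕ) : Set where
  constructor path
  field
    word  : Vec Letter len
    count : count-e word ≡ d
open Path public

-- Scanning helper: pos = current (1-indexed) position, ns = number of n's
-- strictly before, us = number of unmarked e's strictly before.
-- An e at position i is marked iff ns ≡ us; st collects unmarked e positions.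
stFrom : ∀ {m} → (pos ns us : ℕ) → Vec Letter m → List ℕ
stFrom pos ns us [] = []
stFrom pos ns us (n ∷ w) = stFrom (suc pos) (suc ns) us w
stFrom pos ns us (e ∷ w) with ns ≟ us
... | yes _ = stFrom (suc pos) ns us w
... | no  _ = pos ∷ stFrom (suc pos) ns (suc us) w

st : ∀ {m} → Vec Letter m → List ℕ
st w = stFrom 1 0 0 w

ValidSubset : ℕ → List ℕ → Set
ValidSubset len J = Linked _<_ J × All (λ j → 1 ≤ j × j ≤ len) J

-- j_k ≥ 2k for all 1 ≤ k ≤ ℓ  (index i : Fin ℓ corresponds to k = i + 1)
GrowthCond : List ℕ → Set
GrowthCond J = (i : Fin (length J)) → 2 * suc (toℕ i) ≤ lookup J i

-- The marking rule only looks at the height ns − us, which never becomes negative: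
-- an n raises it, an e at positive height is unmarked and lowers it, and an e at
-- height 0 is marked and leaves it at 0. So st(C) is the set of down steps of a lattice
-- path. The k-th down step needs k earlier up steps, whence j_k ≥ 2k, and
-- #e + |st| + final height = len gives ℓ ≤ d ≤ len − ℓ. Conversely the last letter is
-- forced: an unmarked e if len ∈ J, a marked e if the final height len − d − ℓ is 0,
-- and n otherwise; removing it gives existence by induction on len. For uniqueness read
-- from the left: at positive height a letter is determined by whether its position lies
-- in st, and at height 0 an n cannot replace a marked e, because starting higher with
-- the same st forces fewer e's.
module Submission where

open import Defs
open import Data.Nat using (ℕ; zero; suc; _+_; _*_; _∸_; _≤_; _<_; z≤n; s≤s; s≤s⁻¹; _≤?_)
open import Data.Nat.Properties
open import Data.List using (List; []; _∷_; _++_; _∷ʳ_; length; lookup; initLast; _∷ʳ′_)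
open import Data.List.Properties using (++-identityʳ; ++-assoc; length-++; ∷-injectiveʳ)
open import Data.List.Membership.Propositional.Properties using (∈-lookup)
open import Data.List.Relation.Unary.All as All using (All; []; _∷_)
open import Data.List.Relation.Unary.All.Properties using (++⁺; ++⁻ʳ)
open import Data.List.Relation.Unary.Linked using (Linked; []; [-]; _∷_)
open import Data.Vec using (Vec; []; _∷_) renaming (_∷ʳ_ to _∷ᵛ_)
open import Data.Fin using (Fin; toℕ; fromℕ; zero; suc)
open import Data.Fin.Properties using (toℕ-fromℕ)
open import Data.Product using (_×_; ∃; _,_; proj₁; proj₂)
open import Data.Unit using (⊤; tt)
open import Function.Bundles using (_⇔_; mk⇔; Equivalence)
open import Relation.Binary.Core using (Rel)
open import Relation.Binary.Definitions using (Transitive)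
open import Relation.Nullary using (yes; no; contradiction)
open import Relation.Binary.PropositionalEquality

step : ℕ → Letter → ℕ
step h       n = suc h
step zero    e = zero
step (suc h) e = h

unmarkedAt : ℕ → ℕ → Letter → List ℕ
unmarkedAt pos h       n = []
unmarkedAt pos zero    e = []
unmarkedAt pos (suc h) e = pos ∷ []

scan : ∀ {m} → ℕ → ℕ → Vec Letter m → List ℕ
scan pos h []      = []
scan pos h (x ∷ w) = unmarkedAt pos h x ++ scan (suc pos) (step h x) w

height : ∀ {m} → ℕ → Vec Letter m → ℕ
height h []      = h
height h (x ∷ w) = height (step h x) w

stFrom≡scan : ∀ {m} pos h us (w : Vec Letter m) → stFrom pos (h + us) us w ≡ scan pos h w
stFrom≡scan pos h us [] = refl
stFrom≡scan pos h us (n ∷ w) = stFrom≡scan (suc pos) (suc h) us w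
stFrom≡scan pos zero us (e ∷ w) with us ≟ us
... | yes _   = stFrom≡scan (suc pos) zero us w
... | no us≢us = contradiction refl us≢us
stFrom≡scan pos (suc h) us (e ∷ w) with suc (h + us) ≟ us
... | yes eq = contradiction (sym eq) (m≢1+n+m us)
... | no _   = cong (pos ∷_) (begin
  stFrom (suc pos) (suc (h + us)) (suc us) w
    ≡⟨ cong (λ ns → stFrom (suc pos) ns (suc us) w) (sym (+-suc h us)) ⟩
  stFrom (suc pos) (h + suc us) (suc us) w
    ≡⟨ stFrom≡scan (suc pos) h (suc us) w ⟩
  scan (suc pos) h w
    ∎)
  where open ≡-Reasoning

st≡scan : ∀ {m} (w : Vec Letter m) → st w ≡ scan 1 0 w
st≡scan = stFrom≡scan 1 0 0

count-e+∣scan∣+height≡h+m : ∀ {m} pos h (w : Vec Letter m) →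
  count-e w + length (scan pos h w) + height h w ≡ h + m
count-e+∣scan∣+height≡h+m pos h [] = sym (+-identityʳ h)
count-e+∣scan∣+height≡h+m {suc m} pos h (n ∷ w) =
  trans (count-e+∣scan∣+height≡h+m (suc pos) (suc h) w) (sym (+-suc h m))
count-e+∣scan∣+height≡h+m pos zero (e ∷ w) = cong suc (count-e+∣scan∣+height≡h+m (suc pos) zero w)
count-e+∣scan∣+height≡h+m {suc m} pos (suc h) (e ∷ w) = begin
  suc (count-e w + suc ℓ + height h w)
    ≡⟨ cong (λ k → suc (k + height h w)) (+-suc (count-e w) ℓ) ⟩
  suc (suc (count-e w + ℓ + height h w))
    ≡⟨ cong (λ k → suc (suc k)) (count-e+∣scan∣+height≡h+m (suc pos) h w) ⟩
  suc (suc (h + m))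
    ≡⟨ cong suc (sym (+-suc h m)) ⟩
  suc (h + suc m)
    ∎
  where
  open ≡-Reasoning
  ℓ = length (scan (suc pos) h w)

∣scan∣≤count-e : ∀ {m} pos h (w : Vec Letter m) → length (scan pos h w) ≤ count-e w
∣scan∣≤count-e pos h [] = z≤n
∣scan∣≤count-e pos h (n ∷ w) = ∣scan∣≤count-e (suc pos) (suc h) w
∣scan∣≤count-e pos zero (e ∷ w) = m≤n⇒m≤1+n (∣scan∣≤count-e (suc pos) zero w)
∣scan∣≤count-e pos (suc h) (e ∷ w) = s≤s (∣scan∣≤count-e (suc pos) h w)

Growth : ℕ → ℕ → List ℕ → Set
Growth h a []      = ⊤
Growth h a (x ∷ J) = a ≤ h + x × Growth h (2 + a) J

Growth-suc⁺ : ∀ {h a} J → Growth h a J → Growth (suc h) (suc a) J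
Growth-suc⁺ []      _          = tt
Growth-suc⁺ (x ∷ J) (a≤ , gJ) = s≤s a≤ , Growth-suc⁺ J gJ

Growth-suc⁻ : ∀ {h a} J → Growth (suc h) (suc a) J → Growth h a J
Growth-suc⁻ []      _          = tt
Growth-suc⁻ (x ∷ J) (a≤ , gJ) = s≤s⁻¹ a≤ , Growth-suc⁻ J gJ

Growth-weaken : ∀ {h a b} J → b ≤ a → Growth h a J → Growth h b J
Growth-weaken []      _   _          = tt
Growth-weaken (x ∷ J) b≤a (a≤ , gJ) = ≤-trans b≤a a≤ , Growth-weaken J (s≤s (s≤s b≤a)) gJ

Growth-∷ʳ⁻ : ∀ {h a} J {x} → Growth h a (J ∷ʳ x) → Growth h a J
Growth-∷ʳ⁻ []      _          = tt
Growth-∷ʳ⁻ (y ∷ J) (a≤ , gJ) = a≤ , Growth-∷ʳ⁻ J gJ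

+-2*suc : ∀ a k → a + 2 * suc k ≡ 2 + a + 2 * k
+-2*suc a k = begin
  a + 2 * suc k         ≡⟨ cong (a +_) (*-suc 2 k) ⟩
  a + suc (suc (2 * k)) ≡⟨ +-suc a (suc (2 * k)) ⟩
  suc (a + suc (2 * k)) ≡⟨ cong suc (+-suc a (2 * k)) ⟩
  2 + a + 2 * k         ∎
  where open ≡-Reasoning

Growth⇒lookup : ∀ {h a} J → Growth h a J → (i : Fin (length J)) → a + 2 * toℕ i ≤ h + lookup J i
Growth⇒lookup {a = a} (x ∷ J) (a≤ , _) zero = ≤-trans (≤-reflexive (+-identityʳ a)) a≤
Growth⇒lookup {a = a} (x ∷ J) (_ , gJ) (suc i) =
  ≤-trans (≤-reflexive (+-2*suc a (toℕ i))) (Growth⇒lookup J gJ i)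

lookup⇒Growth : ∀ {h a} J → ((i : Fin (length J)) → a + 2 * toℕ i ≤ h + lookup J i) → Growth h a J
lookup⇒Growth []      _     = tt
lookup⇒Growth {a = a} (x ∷ J) grows =
  ≤-trans (≤-reflexive (sym (+-identityʳ a))) (grows zero) ,
  lookup⇒Growth J (λ i → ≤-trans (≤-reflexive (sym (+-2*suc a (toℕ i)))) (grows (suc i)))

GrowthCond⇔Growth : ∀ J → GrowthCond J ⇔ Growth 0 2 J
GrowthCond⇔Growth J = mk⇔
  (λ grows → lookup⇒Growth J (λ i → ≤-trans (≤-reflexive (sym (*-suc 2 (toℕ i)))) (grows i)))
  (λ gJ i → ≤-trans (≤-reflexive (*-suc 2 (toℕ i))) (Growth⇒lookup J gJ i))

GrowthCond⇒2*length≤ : ∀ {L} J → GrowthCond J → All (_≤ L) J → 2 * length J ≤ L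
GrowthCond⇒2*length≤ [] _ _ = z≤n
GrowthCond⇒2*length≤ J@(_ ∷ J′) grows bounded = begin
  2 * suc (length J′)         ≡⟨ cong (λ k → 2 * suc k) (sym (toℕ-fromℕ (length J′))) ⟩
  2 * suc (toℕ last)          ≤⟨ grows last ⟩
  lookup J last               ≤⟨ All.lookup bounded (∈-lookup last) ⟩
  _                           ∎
  where
  open ≤-Reasoning
  last = fromℕ (length J′)

scan-growth : ∀ {m} pos h (w : Vec Letter m) → Growth h (suc pos) (scan pos h w)
scan-growth pos h [] = tt
scan-growth pos h (n ∷ w) = Growth-suc⁻ _ (scan-growth (suc pos) (suc h) w)
scan-growth pos zero (e ∷ w) = Growth-weaken _ (n≤1+n (suc pos)) (scan-growth (suc pos) zero w)
scan-growth pos (suc h) (e ∷ w) = s≤s (m≤n+m pos h) , Growth-suc⁺ _ (scan-growth (suc pos) h w)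

scan-lowerBound : ∀ {m} pos h (w : Vec Letter m) → All (pos ≤_) (scan pos h w)
scan-lowerBound pos h [] = []
scan-lowerBound pos h (x ∷ w) = ++⁺ (here h x) (All.map <⇒≤ (scan-lowerBound (suc pos) (step h x) w))
  where
  here : ∀ h x → All (pos ≤_) (unmarkedAt pos h x)
  here h       n = []
  here zero    e = []
  here (suc h) e = ≤-refl ∷ []

scan-suc≢∷ : ∀ {m} pos h (w : Vec Letter m) J → scan (suc pos) h w ≢ pos ∷ J
scan-suc≢∷ pos h w J eq with subst (All (suc pos ≤_)) eq (scan-lowerBound (suc pos) h w)
... | pos<pos ∷ _ = <-irrefl refl pos<pos

fewer-e-from-higher-start : ∀ {m} pos {g g′} (w w′ : Vec Letter m) →
  g < g′ → scan pos g w ≡ scan pos g′ w′ → count-e w′ ≤ count-e w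
fewer-e-from-higher-start pos [] [] _ _ = z≤n
fewer-e-from-higher-start pos (n ∷ w) (n ∷ w′) g<g′ eq =
  fewer-e-from-higher-start (suc pos) w w′ (s≤s g<g′) eq
fewer-e-from-higher-start pos {zero} {suc _} (e ∷ w) (e ∷ w′) _ eq =
  contradiction eq (scan-suc≢∷ pos 0 w _)
fewer-e-from-higher-start pos {suc _} {suc _} (e ∷ w) (e ∷ w′) g<g′ eq =
  s≤s (fewer-e-from-higher-start (suc pos) w w′ (s≤s⁻¹ g<g′) (∷-injectiveʳ eq))
fewer-e-from-higher-start pos {zero} (e ∷ w) (n ∷ w′) _ eq =
  m≤n⇒m≤1+n (fewer-e-from-higher-start (suc pos) w w′ (s≤s z≤n) eq)
fewer-e-from-higher-start pos {suc g} {g′} (e ∷ w) (n ∷ w′) _ eq =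
  contradiction (sym eq) (scan-suc≢∷ pos (suc g′) w′ _)
fewer-e-from-higher-start pos {g} {suc _} (n ∷ w) (e ∷ w′) _ eq =
  contradiction eq (scan-suc≢∷ pos (suc g) w _)

scan-injective : ∀ {m} pos h (w w′ : Vec Letter m) →
  count-e w ≡ count-e w′ → scan pos h w ≡ scan pos h w′ → w ≡ w′
scan-injective pos h [] [] _ _ = refl
scan-injective pos h (n ∷ w) (n ∷ w′) c eq = cong (n ∷_) (scan-injective (suc pos) (suc h) w w′ c eq)
scan-injective pos zero (e ∷ w) (e ∷ w′) c eq =
  cong (e ∷_) (scan-injective (suc pos) zero w w′ (suc-injective c) eq)
scan-injective pos (suc h) (e ∷ w) (e ∷ w′) c eq =
  cong (e ∷_) (scan-injective (suc pos) h w w′ (suc-injective c) (∷-injectiveʳ eq))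
scan-injective pos zero (e ∷ w) (n ∷ w′) c eq =
  contradiction (fewer-e-from-higher-start (suc pos) w w′ (s≤s z≤n) eq) (<⇒≱ (≤-reflexive c))
scan-injective pos zero (n ∷ w) (e ∷ w′) c eq =
  contradiction (fewer-e-from-higher-start (suc pos) w′ w (s≤s z≤n) (sym eq))
                (<⇒≱ (≤-reflexive (sym c)))
scan-injective pos (suc h) (e ∷ w) (n ∷ w′) _ eq =
  contradiction (sym eq) (scan-suc≢∷ pos (2 + h) w′ _)
scan-injective pos (suc h) (n ∷ w) (e ∷ w′) _ eq = contradiction eq (scan-suc≢∷ pos (2 + h) w _)

module _ {a ℓ} {A : Set a} {R : Rel A ℓ} (R-trans : Transitive R) where

  Linked-∷ʳ⁻ : ∀ xs {x} → Linked R (xs ∷ʳ x) → Linked R xs × All (λ y → R y x) xs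
  Linked-∷ʳ⁻ []               _              = [] , []
  Linked-∷ʳ⁻ (y ∷ [])         (Ryx ∷ [-])    = [-] , Ryx ∷ []
  Linked-∷ʳ⁻ (y ∷ xs@(_ ∷ _)) (Ryz ∷ Rxs∷ʳx) with Linked-∷ʳ⁻ xs Rxs∷ʳx
  ... | sorted , Rzx ∷ below = Ryz ∷ sorted , R-trans Ryz Rzx ∷ Rzx ∷ below

count-e-∷ʳ : ∀ {m} (w : Vec Letter m) x → count-e (w ∷ᵛ x) ≡ count-e (x ∷ []) + count-e w
count-e-∷ʳ []      x = sym (+-identityʳ _)
count-e-∷ʳ (n ∷ w) x = count-e-∷ʳ w x
count-e-∷ʳ (e ∷ w) x = trans (cong suc (count-e-∷ʳ w x)) (sym (+-suc _ (count-e w)))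

scan-∷ʳ : ∀ {m} pos h (w : Vec Letter m) x →
  scan pos h (w ∷ᵛ x) ≡ scan pos h w ++ unmarkedAt (pos + m) (height h w) x
scan-∷ʳ pos h [] x = trans (++-identityʳ _) (cong (λ p → unmarkedAt p h x) (sym (+-identityʳ pos)))
scan-∷ʳ {suc m} pos h (y ∷ w) x = begin
  u ++ scan (suc pos) (step h y) (w ∷ᵛ x) ≡⟨ cong (u ++_) (scan-∷ʳ (suc pos) (step h y) w x) ⟩
  u ++ (rest ++ final (suc pos + m))      ≡⟨ sym (++-assoc u rest _) ⟩
  (u ++ rest) ++ final (suc pos + m)      ≡⟨ cong (λ p → (u ++ rest) ++ final p) (sym (+-suc pos m)) ⟩
  (u ++ rest) ++ final (pos + suc m)      ∎
  where
  open ≡-Reasoning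
  u = unmarkedAt pos h y
  rest = scan (suc pos) (step h y) w
  final : ℕ → List ℕ
  final p = unmarkedAt p (height (step h y) w) x

Realization : ℕ → ℕ → List ℕ → Set
Realization L d J = ∃ λ (w : Vec Letter L) → count-e w ≡ d × scan 1 0 w ≡ J

extend-n : ∀ {L d J} → Realization L d J → Realization (suc L) d J
extend-n (w , refl , refl) = w ∷ᵛ n , count-e-∷ʳ w n , trans (scan-∷ʳ 1 0 w n) (++-identityʳ _)

-- The balance count-e + |st| + height = length fixes the final height of w, hence
-- whether an appended e is marked.
extend-marked : ∀ {L d J} → d + length J ≡ L → Realization L d J → Realization (suc L) (suc d) J
extend-marked d+ℓ≡L (w , refl , refl)
  with height 0 w | count-e+∣scan∣+height≡h+m 1 0 w | scan-∷ʳ 1 0 w e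
... | zero  | _       | scan∷ʳ = w ∷ᵛ e , count-e-∷ʳ w e , trans scan∷ʳ (++-identityʳ _)
... | suc _ | balance | _      = contradiction (trans balance (sym d+ℓ≡L)) (m+1+n≢m _)

extend-unmarked : ∀ {L d J} → d + length J < L →
  Realization L d J → Realization (suc L) (suc d) (J ∷ʳ suc L)
extend-unmarked d+ℓ<L (w , refl , refl)
  with height 0 w | count-e+∣scan∣+height≡h+m 1 0 w | scan-∷ʳ 1 0 w e
... | zero  | balance | _      = contradiction (trans (sym (+-identityʳ _)) balance) (<⇒≢ d+ℓ<L)
... | suc _ | _       | scan∷ʳ = w ∷ᵛ e , count-e-∷ʳ w e , scan∷ʳ

mutual
  realize : ∀ L d J → Linked _<_ J → All (_≤ L) J → Growth 0 2 J →
    length J ≤ d → d + length J ≤ L → Realization L d J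
  realize zero zero [] _ _ _ _ _ = [] , refl , refl
  realize zero zero (_ ∷ _) _ _ _ _ ()
  realize zero (suc _) _ _ _ _ _ ()
  realize (suc L) d J sorted bounded grows ℓ≤d d+ℓ≤ with initLast J
  ... | [] = realize-last∉ L d [] sorted [] grows ℓ≤d d+ℓ≤
  ... | J′ ∷ʳ′ x with x ≟ suc L
  ...   | yes refl = realize-last∈ L d J′ sorted grows (≤-trans (≤-reflexive (sym ∣J∣)) ℓ≤d)
                       (≤-trans (≤-reflexive (cong (d +_) (sym ∣J∣))) d+ℓ≤)
    where
    ∣J∣ : length (J′ ∷ʳ suc L) ≡ suc (length J′)
    ∣J∣ = trans (length-++ J′) (+-comm (length J′) 1)
  ...   | no x≢1+L = realize-last∉ L d (J′ ∷ʳ x) sorted bounded′ grows ℓ≤d d+ℓ≤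
    where
    x≤L : x ≤ L
    x≤L = s≤s⁻¹ (≤∧≢⇒< (All.head (++⁻ʳ J′ bounded)) x≢1+L)
    bounded′ : All (_≤ L) (J′ ∷ʳ x)
    bounded′ = ++⁺ (All.map (λ y<x → <⇒≤ (<-≤-trans y<x x≤L)) (proj₂ (Linked-∷ʳ⁻ <-trans J′ sorted)))
                   (x≤L ∷ [])

  realize-last∉ : ∀ L d J → Linked _<_ J → All (_≤ L) J → Growth 0 2 J →
    length J ≤ d → d + length J ≤ suc L → Realization (suc L) d J
  realize-last∉ L d J sorted bounded grows ℓ≤d d+ℓ≤1+L with d + length J ≤? L
  ... | yes d+ℓ≤L = extend-n (realize L d J sorted bounded grows ℓ≤d d+ℓ≤L)
  realize-last∉ L zero J _ _ _ ℓ≤0 _ | no d+ℓ≰L = contradiction (≤-trans ℓ≤0 z≤n) d+ℓ≰L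
  realize-last∉ L (suc d) J sorted bounded grows _ d+ℓ≤1+L | no d+ℓ≰L =
    extend-marked d+ℓ≡L (realize L d J sorted bounded grows ℓ≤d (≤-reflexive d+ℓ≡L))
    where
    d+ℓ≡L : d + length J ≡ L
    d+ℓ≡L = suc-injective (≤-antisym d+ℓ≤1+L (≰⇒> d+ℓ≰L))
    ℓ≤d : length J ≤ d
    ℓ≤d = +-cancelʳ-≤ (length J) (length J) d (begin
      length J + length J       ≡⟨ cong (length J +_) (sym (+-identityʳ (length J))) ⟩
      2 * length J              ≤⟨ GrowthCond⇒2*length≤ J (Equivalence.from (GrowthCond⇔Growth J) grows)
                                                           bounded ⟩
      L                         ≡⟨ sym d+ℓ≡L ⟩
      d + length J              ∎)
      where open ≤-Reasoning

  realize-last∈ : ∀ L d J → Linked _<_ (J ∷ʳ suc L) → Growth 0 2 (J ∷ʳ suc L) →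
    suc (length J) ≤ d → d + suc (length J) ≤ suc L → Realization (suc L) d (J ∷ʳ suc L)
  realize-last∈ L (suc d) J sorted grows (s≤s ℓ≤d) (s≤s d+1+ℓ≤L) =
    extend-unmarked d+ℓ<L (realize L d J sorted′ bounded (Growth-∷ʳ⁻ J grows) ℓ≤d (<⇒≤ d+ℓ<L))
    where
    d+ℓ<L : d + length J < L
    d+ℓ<L = ≤-trans (≤-reflexive (sym (+-suc d (length J)))) d+1+ℓ≤L
    sorted′ : Linked _<_ J
    sorted′ = proj₁ (Linked-∷ʳ⁻ <-trans J sorted)
    bounded : All (_≤ L) J
    bounded = All.map s≤s⁻¹ (proj₂ (Linked-∷ʳ⁻ <-trans J sorted))

st-necessary : ∀ {m} (w : Vec Letter m) →
  GrowthCond (st w) × length (st w) ≤ count-e w × count-e w ≤ m ∸ length (st w)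
st-necessary {m} w rewrite st≡scan w =
  Equivalence.from (GrowthCond⇔Growth (scan 1 0 w)) (scan-growth 1 0 w) ,
  ∣scan∣≤count-e 1 0 w ,
  m+n≤o⇒m≤o∸n (count-e w)
    (≤-trans (m≤m+n _ (height 0 w)) (≤-reflexive (count-e+∣scan∣+height≡h+m 1 0 w)))

st-sufficient : ∀ {m d J} → Linked _<_ J → All (_≤ m) J →
  GrowthCond J → length J ≤ d → d ≤ m ∸ length J →
  ∃ λ (w : Vec Letter m) → count-e w ≡ d × st w ≡ J
st-sufficient {m} {d} {J} sorted bounded grows ℓ≤d d≤m∸ℓ
  with realize m d J sorted bounded (Equivalence.to (GrowthCond⇔Growth J) grows) ℓ≤d d+ℓ≤m
  where
  ℓ≤m : length J ≤ m
  ℓ≤m = ≤-trans ℓ≤d (≤-trans d≤m∸ℓ (m∸n≤m m (length J)))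
  d+ℓ≤m : d + length J ≤ m
  d+ℓ≤m = m≤o∸n⇒m+n≤o d ℓ≤m d≤m∸ℓ
... | w , counted , scanned = w , counted , trans (st≡scan w) scanned

st-injective : ∀ {m} (w w′ : Vec Letter m) →
  count-e w ≡ count-e w′ → st w ≡ st w′ → w ≡ w′
st-injective w w′ c eq = scan-injective 1 0 w w′ c (trans (sym (st≡scan w)) (trans eq (st≡scan w′)))

proposition4p14 : (len d : ℕ) (J : List ℕ) → ValidSubset len J →
    ((∃ λ (C : Path len d) → st (word C) ≡ J) ⇔
      (GrowthCond J × length J ≤ d × d ≤ len ∸ length J))
    × ((C C′ : Path len d) → st (word C) ≡ J → st (word C′) ≡ J → word C ≡ word C′)
proposition4p14 len d J (sorted , inRange) = mk⇔ necessary sufficient , unique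
  where
  Realized = ∃ λ (C : Path len d) → st (word C) ≡ J
  Conditions = GrowthCond J × length J ≤ d × d ≤ len ∸ length J

  necessary : Realized → Conditions
  necessary (path w refl , refl) = st-necessary w

  sufficient : Conditions → Realized
  sufficient (grows , ℓ≤d , d≤len∸ℓ)
    with st-sufficient sorted (All.map proj₂ inRange) grows ℓ≤d d≤len∸ℓ
  ... | w , counted , st≡J = path w counted , st≡J

  unique : (C C′ : Path len d) → st (word C) ≡ J → st (word C′) ≡ J → word C ≡ word C′
  unique C C′ st≡J st′≡J =
    st-injective (word C) (word C′) (trans (count C) (sym (count C′))) (trans st≡J (sym st′≡J))
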